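{- Let $X$ be a finite connected simplicial complex with vertices $v_1,\dots,v_m$. Then for every $j\ge0$, $$\ddot{\mathrm{H}}^0_j(X)\cong\mathbb{F}^{n_j}_{(j,j+1)},$$ where $n_j$ is the number of $j$-dimensional simplices in $\bigcap_{i=1}^m\overline{St(v_i)}$.
   Context: $\mathbb{F}$ is the field with two elements; $C(X)$ is the simplicial chain complex of $X$ over $\mathbb{F}$. A colouring $\varepsilon\in\mathbb{Z}_2^m$ colours $v_i$ black if $\varepsilon(i)=1$ and white otherwise; $|\varepsilon|$ is the number of black vertices; the weight of a simplex is its number of white vertices. The horizontal differential $\partial_h^\varepsilon$ sends a simplex $\sigma$ to the sum of its faces $\sigma\setminus\{v\}$ over black vertices $v\in\sigma$; $\mathrm{H}^h(X,\varepsilon)$ is the homology of $(C(X),\partial_h^\varepsilon)$, bigraded by (dimension, weight). For colourings $\varepsilon,\varepsilon'$ differing only at index $i$, with $\varepsilon(i)=0,\varepsilon'(i)=1$, the map $d_{\varepsilon\to\varepsilon'}:\mathrm{H}^h(X,\varepsilon)\to\mathrm{H}^h(X,\varepsilon')$ sends the class of a cycle $x$ (a sum of simplices) to the class of the sum of those simplices of $x$ not containing $v_i$. The \"uber complex is $\ddot{C}^j(X)=\bigoplus_{|\varepsilon|=j}\mathrm{H}^h(X,\varepsilon)$ with differential $d^j$ the sum of all $d_{\varepsilon\to\varepsilon'}$ with $|\varepsilon|=j$; its homology is the \"uberhomology $\ddot{\mathrm{H}}^j(X)$, triply graded, with $\ddot{\mathrm{H}}^j_i(X,k)$ the part in homological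 degree $j$, simplex dimension $i$ and weight $k$, and $\ddot{\mathrm{H}}^j_i(X)=\bigoplus_k\ddot{\mathrm{H}}^j_i(X,k)$. $\mathbb{F}^n_{(a,b)}$ is an $n$-dimensional space concentrated in (dimension, weight) $=(a,b)$. The closed star $\overline{St(v)}$ is the subcomplex of all simplices containing $v$ together with their faces. -}

module Defs where

open import Data.Nat using (ℕ; zero; suc)
open import Data.Bool using (Bool; true; false; not; _∧_; _xor_; T; if_then_else_)
open import Data.Fin using (Fin; zero; suc)
open import Data.Fin.Subset using (Subset; _∈_; _⊆_; _∪_; _∩_; ⁅_⁆; ∣_∣)
open import Data.Vec using (Vec; lookup; tabulate)
open import Data.Product using (Σ; _×_; ∃; ∃-syntax)
open import Relation.Binary.PropositionalEquality using (_≡_; _≢_)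

record SimplicialComplex (m : ℕ) : Set where
  field
    face? : Subset m → Bool
    face-nonempty : ∀ σ → T (face? σ) → ∣ σ ∣ ≢ 0
    down-closed : ∀ σ τ → T (face? σ) → τ ⊆ σ → ∣ τ ∣ ≢ 0 → T (face? τ)
    vertex : ∀ (i : Fin m) → T (face? ⁅ i ⁆)
open SimplicialComplex public

IsSimplex : ∀ {m} → SimplicialComplex m → Subset m → Set
IsSimplex X σ = T (face? X σ)

data Reach {m} (X : SimplicialComplex m) : Fin m → Fin m → Set where
  here : ∀ a → Reach X a a
  step : ∀ a b c → IsSimplex X (⁅ a ⁆ ∪ ⁅ b ⁆) → Reach X b c → Reach X a c

Connected : ∀ {m} → SimplicialComplex m → Set
Connected {m} X = ∀ (a b : Fin m) → Reach X a b

-- colourings ε ∈ ℤ₂^m : true = black, false = white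
Colouring : ℕ → Set
Colouring m = Fin m → Bool

allWhite : ∀ {m} → Colouring m
allWhite _ = false

∣_∣ᶜ : ∀ {m} → Colouring m → ℕ
∣ ε ∣ᶜ = ∣ tabulate ε ∣

weight : ∀ {m} → Colouring m → Subset m → ℕ
weight ε σ = ∣ σ ∩ tabulate (λ v → not (ε v)) ∣

DiffAt : ∀ {m} → Colouring m → Colouring m → Fin m → Set
DiffAt {m} ε ε' i = (ε i ≡ false) × (ε' i ≡ true) × (∀ (l : Fin m) → l ≢ i → ε l ≡ ε' l)

-- F-chains: an F-valued function on (nonempty) subsets, i.e. a sum of simplices
Chain : ℕ → Set
Chain m = Subset m → Bool

0ᶜ : ∀ {m} → Chain m
0ᶜ _ = false

_+ᶜ_ : ∀ {m} → Chain m → Chain m → Chain m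
(c +ᶜ c') σ = c σ xor c' σ

_≐_ : ∀ {m} → Chain m → Chain m → Set
c ≐ c' = ∀ σ → c σ ≡ c' σ

InX : ∀ {m} → SimplicialComplex m → Chain m → Set
InX X c = ∀ σ → T (c σ) → IsSimplex X σ

⨁ : ∀ {m} → (Fin m → Bool) → Bool
⨁ {zero} f = false
⨁ {suc m} f = f zero xor ⨁ (λ i → f (suc i))

nz : ℕ → Bool
nz zero = false
nz (suc _) = true

-- horizontal differential: σ ↦ Σ_{v ∈ σ black} σ∖{v}.
-- Coefficient of a nonempty τ in ∂c is the sum over black v ∉ τ of c(τ ∪ {v}).
∂h : ∀ {m} → Colouring m → Chain m → Chain m
∂h ε c τ = nz ∣ τ ∣ ∧ ⨁ (λ v → not (lookup τ v) ∧ (ε v ∧ c (τ ∪ ⁅ v ⁆)))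

Cycle : ∀ {m} → Colouring m → Chain m → Set
Cycle ε c = ∂h ε c ≐ 0ᶜ

Boundary : ∀ {m} → SimplicialComplex m → Colouring m → Chain m → Set
Boundary X ε c = ∃[ b ] (InX X b × (∂h ε b ≐ c))

Homogeneous : ∀ {m} → Colouring m → ℕ → ℕ → Chain m → Set
Homogeneous ε j k c = ∀ σ → T (c σ) → (∣ σ ∣ ≡ suc j) × (weight ε σ ≡ k)

-- representatives of classes in H^h(X,ε) in bidegree (j,k)
HhRep : ∀ {m} → SimplicialComplex m → Colouring m → ℕ → ℕ → Chain m → Set
HhRep X ε j k c = InX X c × Homogeneous ε j k c × Cycle ε c

SameClass : ∀ {m} → SimplicialComplex m → Colouring m → Chain m → Chain m → Set
SameClass X ε c c' = Boundary X ε (c +ᶜ c')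

-- representative-level map d_{ε→ε'} (ε,ε' differing at i): drop simplices containing v_i
dmap : ∀ {m} → Fin m → Chain m → Chain m
dmap i c σ = c σ ∧ not (lookup σ i)

-- Ü^0_j(X,k) = ker d^0 (C̈^{-1} = 0): classes [x] ∈ H^h(X,ε₀) (ε₀ all white, |ε₀|=0)
-- in bidegree (j,k) with d_{ε₀→ε'}[x] = 0 for every ε' adjacent to ε₀;
-- two representatives are identified by SameClass X allWhite.
UberH0Rep : ∀ {m} → SimplicialComplex m → ℕ → ℕ → Chain m → Set
UberH0Rep {m} X j k c =
  HhRep X allWhite j k c ×
  (∀ (ε' : Colouring m) (i : Fin m) → DiffAt allWhite ε' i →
     Boundary X ε' (dmap i c))

InClosedStar : ∀ {m} → SimplicialComplex m → Fin m → Subset m → Set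
InClosedStar X v σ = ∃[ τ ] (IsSimplex X τ × (v ∈ τ) × (σ ⊆ τ))

InStarIntersection : ∀ {m} → SimplicialComplex m → ℕ → Subset m → Set
InStarIntersection {m} X j σ =
  IsSimplex X σ × (∣ σ ∣ ≡ suc j) × (∀ (i : Fin m) → InClosedStar X i σ)

_⊕ᵛ_ : ∀ {n} → Vec Bool n → Vec Bool n → Vec Bool n
_⊕ᵛ_ = Data.Vec.zipWith _xor_

-- For the all-white colouring ε₀ the horizontal differential vanishes, so a class of H^h(X, ε₀) is a
-- single chain, and since every vertex is white a homogeneous chain of dimension j has weight k = j + 1.
-- For the colouring whose only black vertex is vᵢ, the differential sends b to the sum of the faces τ ∌ vᵢ
-- with τ ∪ {vᵢ} ∈ b. Hence d_{ε₀→ε'}[c] = 0 exactly when every simplex σ ∌ vᵢ of c spans a simplex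
-- σ ∪ {vᵢ} of X (the cone of c over vᵢ is then a primitive), i.e. when σ lies in the closed star of vᵢ.
-- So ker d⁰ consists of the chains supported on the j-simplices of ⋂ᵢ St̄(vᵢ), and reading off the
-- coefficients along an enumeration of these simplices identifies it with 𝔽^{n_j}.

module Submission where

open import Defs
open import Data.Nat using (ℕ; zero; suc; _≡ᵇ_; _≤_)
open import Data.Nat.Properties using (≡ᵇ⇒≡; ≡⇒≡ᵇ)
open import Data.Bool using (Bool; true; false; not; _∧_; _xor_; T; if_then_else_)
import Data.Bool as Bool
open import Data.Bool.Properties
  using (∧-zeroʳ; ∧-identityʳ; ∨-identityʳ; xor-identityʳ; xor-same; T-∧; T-≡; T-not-≡)
open import Data.Fin using (Fin; zero; suc) renaming (_≟_ to _≟ᶠ_)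
open import Data.Fin.Properties using (suc-injective)
open import Data.Fin.Subset using (Subset; ⊥; _∪_; _∩_; _-_; ⁅_⁆; ∣_∣; _⊆_; _∈_)
open import Data.Fin.Subset.Properties
  using (_∈?_; x∈p∪q⁻; x∈p∪q⁺; x∈⁅x⁆; x∈⁅y⁆⇒x≡y; p⊆p∪q; q⊆p∪q; ∣⁅x⁆∣≡1; p⊆q⇒∣p∣≤∣q∣;
         ∩-identityʳ; ∪-identityʳ; p─⊥≡p)
open import Data.Vec using (Vec; []; _∷_; lookup; map; fromList)
open import Data.Vec.Properties using (≡-dec; []=⇒lookup; lookup⇒[]=; ∷-injective; tabulate-∘; map-const)
open import Data.List using (List; []; _∷_; length)
open import Data.List.Membership.Propositional using () renaming (_∈_ to _∈ˡ_)
open import Data.List.Relation.Unary.Any using (here; there)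
import Data.List.Relation.Unary.All as All
open import Data.List.Relation.Unary.AllPairs using ([]; _∷_)
open import Data.List.Relation.Unary.Unique.Propositional using (Unique)
open import Data.Product using (Σ; _×_; ∃; ∃-syntax; _,_; proj₁; proj₂)
open import Data.Sum using (inj₂; [_,_])
open import Data.Empty using (⊥-elim)
open import Function using (id)
open import Function.Bundles using (_⇔_; mk⇔; Equivalence)
open Equivalence using (to; from)
import Function.Properties.Equivalence as ⇔
open import Relation.Nullary using (yes; no; does; ¬_)
open import Relation.Nullary.Decidable using (dec-true; dec-false)
open import Relation.Binary.Definitions using (DecidableEquality)
open import Relation.Binary.PropositionalEquality
  using (_≡_; _≢_; refl; sym; trans; cong; cong₂; subst; subst₂; module ≡-Reasoning)

xor≡false⇒≡ : ∀ x y → x xor y ≡ false → x ≡ y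
xor≡false⇒≡ false false _ = refl
xor≡false⇒≡ true  true  _ = refl

T-∧⁻ʳ : ∀ x {y} → T (x ∧ y) → T y
T-∧⁻ʳ true t = t

∧-redundant : ∀ {x y z} → (T z → x ≡ true) → (T z → y ≡ true) → x ∧ (y ∧ z) ≡ z
∧-redundant {x} {y} {false} _ _ = trans (cong (x ∧_) (∧-zeroʳ y)) (∧-zeroʳ x)
∧-redundant {x} {y} {true}  x≡1 y≡1 rewrite x≡1 _ | y≡1 _ = refl

nz-nonzero : ∀ {n} → n ≢ 0 → nz n ≡ true
nz-nonzero {zero}  n≢0 = ⊥-elim (n≢0 refl)
nz-nonzero {suc n} _   = refl

⨁-zero : ∀ {m} (f : Fin m → Bool) → (∀ v → f v ≡ false) → ⨁ f ≡ false
⨁-zero {zero} f _ = refl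
⨁-zero {suc m} f f≡0 rewrite f≡0 zero = ⨁-zero (λ v → f (suc v)) (λ v → f≡0 (suc v))

⨁-single : ∀ {m} (f : Fin m → Bool) (i : Fin m) → (∀ v → v ≢ i → f v ≡ false) → ⨁ f ≡ f i
⨁-single {suc m} f zero f≡0 =
  trans (cong (f zero xor_) (⨁-zero _ (λ v → f≡0 (suc v) (λ ())))) (xor-identityʳ _)
⨁-single {suc m} f (suc i) f≡0 rewrite f≡0 zero (λ ()) =
  ⨁-single (λ v → f (suc v)) i (λ v v≢i → f≡0 (suc v) (λ e → v≢i (suc-injective e)))

∣p∪⁅x⁆∣≢0 : ∀ {m} (p : Subset m) (x : Fin m) → ∣ p ∪ ⁅ x ⁆ ∣ ≢ 0
∣p∪⁅x⁆∣≢0 p x ∣p∪x∣≡0 with subst₂ _≤_ (∣⁅x⁆∣≡1 x) ∣p∪x∣≡0 (p⊆q⇒∣p∣≤∣q∣ (q⊆p∪q p ⁅ x ⁆))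
... | ()

lookup-p∪⁅x⁆ : ∀ {m} (p : Subset m) (x : Fin m) → lookup (p ∪ ⁅ x ⁆) x ≡ true
lookup-p∪⁅x⁆ p x = []=⇒lookup (x∈p∪q⁺ {p = p} (inj₂ (x∈⁅x⁆ x)))

∉⇒lookup≡false : ∀ {m} {x : Fin m} (p : Subset m) → ¬ x ∈ p → lookup p x ≡ false
∉⇒lookup≡false {x = x} p x∉p with lookup p x in e
... | true  = ⊥-elim (x∉p (lookup⇒[]= x p e))
... | false = refl

p∪⁅x⁆-x≡p : ∀ {m} (p : Subset m) (x : Fin m) → lookup p x ≡ false → (p ∪ ⁅ x ⁆) - x ≡ p
p∪⁅x⁆-x≡p (b ∷ p) zero    refl = cong (false ∷_) (trans (p─⊥≡p (p ∪ ⊥)) (∪-identityʳ p))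
p∪⁅x⁆-x≡p (b ∷ p) (suc x) x∉p  = cong₂ _∷_ (∨-identityʳ b) (p∪⁅x⁆-x≡p p x x∉p)

p∪⁅x⁆⊆q : ∀ {m} {p q : Subset m} {x : Fin m} → p ⊆ q → x ∈ q → p ∪ ⁅ x ⁆ ⊆ q
p∪⁅x⁆⊆q {p = p} {q} {x} p⊆q x∈q y∈p∪x =
  [ p⊆q , (λ y∈x → subst (_∈ q) (sym (x∈⁅y⁆⇒x≡y x y∈x)) x∈q) ] (x∈p∪q⁻ p ⁅ x ⁆ y∈p∪x)

weight-allWhite : ∀ {m} (σ : Subset m) → weight allWhite σ ≡ ∣ σ ∣
weight-allWhite σ = trans
  (cong (λ p → ∣ σ ∩ p ∣) (trans (tabulate-∘ (λ _ → true) id) (map-const _ true)))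
  (cong ∣_∣ (∩-identityʳ σ))

∂h-allWhite : ∀ {m} (c : Chain m) → ∂h allWhite c ≐ 0ᶜ
∂h-allWhite c τ = trans (cong (nz ∣ τ ∣ ∧_) (⨁-zero _ (λ v → ∧-zeroʳ (not (lookup τ v))))) (∧-zeroʳ _)

sameClass-allWhite⇔≐ : ∀ {m} (X : SimplicialComplex m) (c c' : Chain m) →
                       SameClass X allWhite c c' ⇔ (c ≐ c')
sameClass-allWhite⇔≐ X c c' = mk⇔
  (λ (b , _ , ∂b≐c+c') σ → xor≡false⇒≡ (c σ) (c' σ) (trans (sym (∂b≐c+c' σ)) (∂h-allWhite b σ)))
  (λ c≐c' → 0ᶜ , (λ _ ()) , λ τ →
    trans (∂h-allWhite 0ᶜ τ) (sym (trans (cong (_xor c' τ) (c≐c' τ)) (xor-same (c' τ)))))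

blackAt : ∀ {m} → Fin m → Colouring m
blackAt i v = does (v ≟ᶠ i)

blackAt-diffAt : ∀ {m} (i : Fin m) → DiffAt allWhite (blackAt i) i
blackAt-diffAt i = refl , dec-true (i ≟ᶠ i) refl , λ v v≢i → sym (dec-false (v ≟ᶠ i) v≢i)

∂h-diffAt : ∀ {m} {ε : Colouring m} {i : Fin m} → DiffAt allWhite ε i → ∀ (b : Chain m) τ →
            ∂h ε b τ ≡ nz ∣ τ ∣ ∧ (not (lookup τ i) ∧ b (τ ∪ ⁅ i ⁆))
∂h-diffAt {ε = ε} {i} (_ , εi≡true , white-elsewhere) b τ = cong (nz ∣ τ ∣ ∧_) (begin
  ⨁ summand                          ≡⟨ ⨁-single summand i vanishes ⟩
  summand i                          ≡⟨ cong (λ x → not (lookup τ i) ∧ (x ∧ b (τ ∪ ⁅ i ⁆))) εi≡true ⟩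
  not (lookup τ i) ∧ b (τ ∪ ⁅ i ⁆)  ∎)
  where
  open ≡-Reasoning
  summand : Fin _ → Bool
  summand v = not (lookup τ v) ∧ (ε v ∧ b (τ ∪ ⁅ v ⁆))
  vanishes : ∀ v → v ≢ i → summand v ≡ false
  vanishes v v≢i rewrite sym (white-elsewhere v v≢i) = ∧-zeroʳ _

inClosedStar⇔coface : ∀ {m} (X : SimplicialComplex m) (i : Fin m) (σ : Subset m) →
                      InClosedStar X i σ ⇔ IsSimplex X (σ ∪ ⁅ i ⁆)
inClosedStar⇔coface X i σ = mk⇔
  (λ (τ , τ∈X , i∈τ , σ⊆τ) → down-closed X τ (σ ∪ ⁅ i ⁆) τ∈X (p∪⁅x⁆⊆q σ⊆τ i∈τ) (∣p∪⁅x⁆∣≢0 σ i))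
  (λ σ∪i∈X → σ ∪ ⁅ i ⁆ , σ∪i∈X , x∈p∪q⁺ (inj₂ (x∈⁅x⁆ i)) , λ {_} → p⊆p∪q ⁅ i ⁆)

dmapBoundary⇒coface : ∀ {m} (X : SimplicialComplex m) {ε : Colouring m} {i : Fin m} {c : Chain m} {σ} →
  DiffAt allWhite ε i → Boundary X ε (dmap i c) → T (dmap i c σ) → IsSimplex X (σ ∪ ⁅ i ⁆)
dmapBoundary⇒coface X {i = i} {σ = σ} d (b , b∈X , ∂b≐dc) t =
  b∈X (σ ∪ ⁅ i ⁆) (T-∧⁻ʳ (not (lookup σ i)) (T-∧⁻ʳ (nz ∣ σ ∣) t∂b))
  where
  t∂b : T (nz ∣ σ ∣ ∧ (not (lookup σ i) ∧ b (σ ∪ ⁅ i ⁆)))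
  t∂b = subst T (trans (sym (∂b≐dc σ)) (∂h-diffAt d b σ)) t

cone : ∀ {m} → SimplicialComplex m → Fin m → Chain m → Chain m
cone X i c ρ = face? X ρ ∧ (lookup ρ i ∧ c (ρ - i))

cone-inX : ∀ {m} (X : SimplicialComplex m) (i : Fin m) (c : Chain m) → InX X (cone X i c)
cone-inX X i c ρ t = proj₁ (to T-∧ t)

cone-at-coface : ∀ {m} (X : SimplicialComplex m) (i : Fin m) (c : Chain m) τ → lookup τ i ≡ false →
                 cone X i c (τ ∪ ⁅ i ⁆) ≡ face? X (τ ∪ ⁅ i ⁆) ∧ c τ
cone-at-coface X i c τ i∉τ =
  cong₂ (λ b ρ → face? X (τ ∪ ⁅ i ⁆) ∧ (b ∧ c ρ)) (lookup-p∪⁅x⁆ τ i) (p∪⁅x⁆-x≡p τ i i∉τ)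

∂h-cone : ∀ {m} (X : SimplicialComplex m) {ε : Colouring m} {i : Fin m} {c : Chain m} →
  DiffAt allWhite ε i → InX X c → (∀ τ → T (c τ) → IsSimplex X (τ ∪ ⁅ i ⁆)) →
  ∂h ε (cone X i c) ≐ dmap i c
∂h-cone X {i = i} {c} d c∈X cofaces τ = trans (∂h-diffAt d (cone X i c) τ) coned
  where
  coned : nz ∣ τ ∣ ∧ (not (lookup τ i) ∧ cone X i c (τ ∪ ⁅ i ⁆)) ≡ c τ ∧ not (lookup τ i)
  coned with lookup τ i in i∉τ
  ... | true  = trans (∧-zeroʳ _) (sym (∧-zeroʳ _))
  ... | false = begin
    nz ∣ τ ∣ ∧ cone X i c (τ ∪ ⁅ i ⁆)             ≡⟨ cong (nz ∣ τ ∣ ∧_) (cone-at-coface X i c τ i∉τ) ⟩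
    nz ∣ τ ∣ ∧ (face? X (τ ∪ ⁅ i ⁆) ∧ c τ)        ≡⟨ ∧-redundant (λ t → nz-nonzero (face-nonempty X τ (c∈X τ t)))
                                                                   (λ t → to T-≡ (cofaces τ t)) ⟩
    c τ                                          ≡⟨ ∧-identityʳ (c τ) ⟨
    c τ ∧ true                                   ∎
    where open ≡-Reasoning

SupportedIn : ∀ {m} → (Subset m → Set) → Chain m → Set
SupportedIn P c = ∀ σ → T (c σ) → P σ

UberH0Simplex : ∀ {m} → SimplicialComplex m → ℕ → ℕ → Subset m → Set
UberH0Simplex X j k σ = InStarIntersection X j σ × k ≡ suc j

uberH0Rep⇒supported : ∀ {m} (X : SimplicialComplex m) {j k : ℕ} {c : Chain m} →
                      UberH0Rep X j k c → SupportedIn (UberH0Simplex X j k) c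
uberH0Rep⇒supported X ((c∈X , homogeneous , _) , boundaries) σ t =
  (c∈X σ t , ∣σ∣≡1+j , inStar) , trans (sym weight≡k) (trans (weight-allWhite σ) ∣σ∣≡1+j)
  where
  ∣σ∣≡1+j = proj₁ (homogeneous σ t)
  weight≡k = proj₂ (homogeneous σ t)
  inStar : ∀ i → InClosedStar X i σ
  inStar i with i ∈? σ
  ... | yes i∈σ = σ , c∈X σ t , i∈σ , id
  ... | no  i∉σ = from (inClosedStar⇔coface X i σ)
    (dmapBoundary⇒coface X (blackAt-diffAt i) (boundaries (blackAt i) i (blackAt-diffAt i))
      (from T-∧ (t , from T-not-≡ (∉⇒lookup≡false σ i∉σ))))

supported⇒uberH0Rep : ∀ {m} (X : SimplicialComplex m) {j k : ℕ} {c : Chain m} →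
                      SupportedIn (UberH0Simplex X j k) c → UberH0Rep X j k c
supported⇒uberH0Rep X {c = c} supported = (c∈X , homogeneous , ∂h-allWhite c) , boundaries
  where
  c∈X : InX X c
  c∈X σ t = proj₁ (proj₁ (supported σ t))
  homogeneous : Homogeneous allWhite _ _ c
  homogeneous σ t with supported σ t
  ... | (_ , ∣σ∣≡1+j , _) , k≡1+j = ∣σ∣≡1+j , trans (weight-allWhite σ) (trans ∣σ∣≡1+j (sym k≡1+j))
  boundaries : ∀ ε i → DiffAt allWhite ε i → Boundary X ε (dmap i c)
  boundaries ε i d = cone X i c , cone-inX X i c , ∂h-cone X d c∈X
    (λ τ t → to (inClosedStar⇔coface X i τ) (proj₂ (proj₂ (proj₁ (supported τ t))) i))

uberH0Rep⇔supported : ∀ {m} (X : SimplicialComplex m) (j k : ℕ) (c : Chain m) →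
                      UberH0Rep X j k c ⇔ SupportedIn (UberH0Simplex X j k) c
uberH0Rep⇔supported X j k c = mk⇔ (uberH0Rep⇒supported X) (supported⇒uberH0Rep X)

LinearIsoOnClasses : ∀ {m} → (Chain m → Set) → (Chain m → Chain m → Set) → ℕ → Set
LinearIsoOnClasses {m} Rep _~_ n =
  Σ (Chain m → Vec Bool n) λ f →
    (∀ c c' → Rep c → Rep c' → f (c +ᶜ c') ≡ (f c ⊕ᵛ f c')) ×
    (∀ c c' → Rep c → Rep c' → (f c ≡ f c') ⇔ (c ~ c')) ×
    (∀ (w : Vec Bool n) → ∃[ c ] (Rep c × f c ≡ w))

linearIsoOnClasses-cong : ∀ {m} {Rep Rep' : Chain m → Set} {_~_ _≈_ : Chain m → Chain m → Set} {n} →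
  (∀ c → Rep c ⇔ Rep' c) → (∀ c c' → (c ~ c') ⇔ (c ≈ c')) →
  LinearIsoOnClasses Rep' _≈_ n → LinearIsoOnClasses Rep _~_ n
linearIsoOnClasses-cong Rep⇔ ~⇔≈ (f , additive , classes , onto) =
  f ,
  (λ c c' r r' → additive c c' (to (Rep⇔ c) r) (to (Rep⇔ c') r')) ,
  (λ c c' r r' → ⇔.trans (classes c c' (to (Rep⇔ c) r) (to (Rep⇔ c') r')) (⇔.sym (~⇔≈ c c'))) ,
  (λ w → let (c , r , fc≡w) = onto w in c , from (Rep⇔ c) r , fc≡w)

coords : ∀ {m} (L : List (Subset m)) → Chain m → Vec Bool (length L)
coords L c = map c (fromList L)

coords-+ᶜ : ∀ {m} (L : List (Subset m)) (c c' : Chain m) →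
            coords L (c +ᶜ c') ≡ (coords L c ⊕ᵛ coords L c')
coords-+ᶜ []      c c' = refl
coords-+ᶜ (σ ∷ L) c c' = cong ((c σ xor c' σ) ∷_) (coords-+ᶜ L c c')

coords-congOn : ∀ {m} (L : List (Subset m)) {c c' : Chain m} →
                (∀ σ → σ ∈ˡ L → c σ ≡ c' σ) → coords L c ≡ coords L c'
coords-congOn []      _     = refl
coords-congOn (σ ∷ L) c≡c' = cong₂ _∷_ (c≡c' σ (here refl)) (coords-congOn L (λ τ τ∈L → c≡c' τ (there τ∈L)))

coords-≡⇒≡ : ∀ {m} {L : List (Subset m)} {c c' : Chain m} {σ} →
             σ ∈ˡ L → coords L c ≡ coords L c' → c σ ≡ c' σ
coords-≡⇒≡ (here refl) eq = proj₁ (∷-injective eq)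
coords-≡⇒≡ (there σ∈L) eq = coords-≡⇒≡ σ∈L (proj₂ (∷-injective eq))

coords-injective : ∀ {m} (L : List (Subset m)) {c c' : Chain m} →
  SupportedIn (_∈ˡ L) c → SupportedIn (_∈ˡ L) c' → coords L c ≡ coords L c' → c ≐ c'
coords-injective L {c} {c'} c⊆L c'⊆L eq σ with c σ in cσ | c' σ in c'σ
... | false | false = refl
... | true  | _     = trans (sym cσ) (trans (coords-≡⇒≡ (c⊆L σ (from T-≡ cσ)) eq) c'σ)
... | false | true  = trans (sym cσ) (trans (coords-≡⇒≡ (c'⊆L σ (from T-≡ c'σ)) eq) c'σ)

_≟ˢ_ : ∀ {m} → DecidableEquality (Subset m)
_≟ˢ_ = ≡-dec Bool._≟_

fromCoords : ∀ {m} (L : List (Subset m)) → Vec Bool (length L) → Chain m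
fromCoords []      []      σ = false
fromCoords (τ ∷ L) (x ∷ w) σ = if does (σ ≟ˢ τ) then x else fromCoords L w σ

fromCoords-supported : ∀ {m} (L : List (Subset m)) (w : Vec Bool (length L)) →
                       SupportedIn (_∈ˡ L) (fromCoords L w)
fromCoords-supported []      []      σ ()
fromCoords-supported (τ ∷ L) (x ∷ w) σ t with σ ≟ˢ τ
... | yes σ≡τ = here σ≡τ
... | no  _   = there (fromCoords-supported L w σ t)

fromCoords-head : ∀ {m} τ (L : List (Subset m)) x w → fromCoords (τ ∷ L) (x ∷ w) τ ≡ x
fromCoords-head τ L x w rewrite dec-true (τ ≟ˢ τ) refl = refl

fromCoords-tail : ∀ {m} τ (L : List (Subset m)) x w {σ} → σ ≢ τ →
                  fromCoords (τ ∷ L) (x ∷ w) σ ≡ fromCoords L w σ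
fromCoords-tail τ L x w {σ} σ≢τ rewrite dec-false (σ ≟ˢ τ) σ≢τ = refl

coords-fromCoords : ∀ {m} (L : List (Subset m)) (w : Vec Bool (length L)) → Unique L →
                    coords L (fromCoords L w) ≡ w
coords-fromCoords []      []      _             = refl
coords-fromCoords (τ ∷ L) (x ∷ w) (τ∉L ∷ uniq) = cong₂ _∷_ (fromCoords-head τ L x w) (begin
  coords L (fromCoords (τ ∷ L) (x ∷ w))  ≡⟨ coords-congOn L (λ σ σ∈L → fromCoords-tail τ L x w (σ≢τ σ∈L)) ⟩
  coords L (fromCoords L w)              ≡⟨ coords-fromCoords L w uniq ⟩
  w                                      ∎)
  where
  open ≡-Reasoning
  σ≢τ : ∀ {σ} → σ ∈ˡ L → σ ≢ τ
  σ≢τ σ∈L σ≡τ = All.lookup τ∉L σ∈L (sym σ≡τ)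

supportedIn-linearIso : ∀ {m} {P : Subset m → Set} (L : List (Subset m)) → Unique L →
                        (∀ σ → (σ ∈ˡ L) ⇔ P σ) → LinearIsoOnClasses (SupportedIn P) _≐_ (length L)
supportedIn-linearIso L uniq L⇔P =
  coords L ,
  (λ c c' _ _ → coords-+ᶜ L c c') ,
  (λ c c' c⊆P c'⊆P →
    mk⇔ (coords-injective L (inL c⊆P) (inL c'⊆P)) (λ c≐c' → coords-congOn L (λ σ _ → c≐c' σ))) ,
  (λ w → fromCoords L w , (λ σ t → to (L⇔P σ) (fromCoords-supported L w σ t)) , coords-fromCoords L w uniq)
  where
  inL : ∀ {c} → SupportedIn _ c → SupportedIn (_∈ˡ L) c
  inL c⊆P σ t = from (L⇔P σ) (c⊆P σ t)

uberH0-linearIso : ∀ {m} (X : SimplicialComplex m) {j k : ℕ} (L : List (Subset m)) → Unique L →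
  (∀ σ → (σ ∈ˡ L) ⇔ UberH0Simplex X j k σ) →
  LinearIsoOnClasses (UberH0Rep X j k) (SameClass X allWhite) (length L)
uberH0-linearIso X {j} {k} L uniq L⇔ =
  linearIsoOnClasses-cong (uberH0Rep⇔supported X j k) (sameClass-allWhite⇔≐ X)
    (supportedIn-linearIso L uniq L⇔)

theorem7p1 : ∀ {m : ℕ} (X : SimplicialComplex m) → Connected X → (j k : ℕ) →
    (L : List (Subset m)) → Unique L → (∀ σ → (σ ∈ˡ L) ⇔ InStarIntersection X j σ) →
    Σ (Chain m → Vec Bool (if k ≡ᵇ suc j then length L else 0)) λ f → ((∀ c c' → UberH0Rep X j k c → UberH0Rep X j k c' →
               f (c +ᶜ c') ≡ (f c ⊕ᵛ f c')) ×
            (∀ c c' → UberH0Rep X j k c → UberH0Rep X j k c' →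
               (f c ≡ f c') ⇔ SameClass X allWhite c c') ×
            (∀ (w : Vec Bool (if k ≡ᵇ suc j then length L else 0)) →
               ∃[ c ] (UberH0Rep X j k c × f c ≡ w)))
theorem7p1 X _ j k L uniq L⇔star with k ≡ᵇ suc j in k≡ᵇ1+j
... | true  = uberH0-linearIso X L uniq λ σ → ⇔.trans (L⇔star σ) (mk⇔ (_, k≡1+j) proj₁)
  where
  k≡1+j : k ≡ suc j
  k≡1+j = ≡ᵇ⇒≡ k (suc j) (subst T (sym k≡ᵇ1+j) _)
... | false = uberH0-linearIso X [] [] λ σ → mk⇔ (λ ()) λ (_ , k≡1+j) →
  ⊥-elim (subst T k≡ᵇ1+j (≡⇒≡ᵇ k (suc j) k≡1+j))
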